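{- For each normal, hereditarily sequential ground type $\gamma$, the tree-size function $\mathrm{ts}_\gamma$ (viewed as a function $\gamma\to\mathsf{nat}$ returning numerals) is $\mathit{RS}_1^-$-computable.
   Context: Ground types are built from $\mathsf{unit}$ and inductive data types $\mu P$ ($P$ a polynomial functor built from $\mathrm{Id}$, constant functors, $+,\times$; $\mu P$ its nonempty least fixed point) by $+,\times$; $\mathsf{nat}=\mu(\mathsf C_{\mathsf{unit}}+\mathrm{Id})$, with numerals $\overline m$. A ground type is hereditarily sequential iff every polynomial functor occurring within it has degree at most one. Values are rooted labelled dags (vertices $\underline{()}$, $\underline\iota_j$, pair, $\underline{\mathsf c}_{\mu P}$) with sharing; two values are bisimilar iff they unfold to the same tree; $\mathrm{size}(v)$ = number of $\underline{\mathsf c}_{\mu P}$ vertices; $\mathrm{ts}_\gamma(v)=\max\{\mathrm{size}(v')\mid v'\text{ bisimilar to }v\}$ (the size of the sharing-free tree) for type-$\gamma$ values $v$. $\mathit{RS}^-_1$ is a ramified (normal/safe) version of the typed first-order $\lambda$-calculus $S_1^-$ (with $\lambda$, application, pairs/projections, injections/case, constructors, destructors, and structural recursion $\mathsf{fold}$): each ground type $\gamma$ has a safe version $\mathsf S\gamma$; safe data have their own constructors/destructors; $\mathsf{fold}_\delta(\lambda z.e_0)\,e_1$ requires $e_1:\delta$ normal and $\lambda z.e_0:P(\mathsf S\gamma)\to\mathsf S\gamma$, result $\mathsf S\gamma$; case requires normal scrutinee type or safe result type; $\mathsf{toSafe}:\gamma\to\mathsf S\gamma$; $\mathsf{toNorm}:\gamma\to\mathsf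 N\gamma$ (all $\mathsf S$ removed) only if all free variables of its argument have normal type; normal types are those with no safe base types. A function $\gamma\to\gamma'$ ($\gamma,\gamma'$ normal) is $\mathit{RS}_1^-$-computable iff some closed $\mathit{RS}_1^-$ term of that type computes it (up to bisimilarity). -}

module Defs where

open import Data.Nat using (ℕ; zero; suc; _+_; _⊔_; _≤_)
open import Data.Unit using (⊤; tt)
open import Data.Sum using (_⊎_; inj₁; inj₂; [_,_])
open import Data.Product using (_×_; _,_; proj₁; proj₂)
open import Data.List using (List; []; _∷_)

mutual
  data Ground : Set where
    unit : Ground
    mu   : Poly → Ground
    _⊕_  : Ground → Ground → Ground
    _⊗_  : Ground → Ground → Ground

  data Poly : Set where
    Id  : Poly
    K   : Ground → Poly
    _⊞_ : Poly → Poly → Poly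
    _⊠_ : Poly → Poly → Poly

-- Values up to bisimilarity = unfolded trees.
-- PVal Q P is the set of values of type Q(μP).

mutual
  data Val : Ground → Set where
    vunit : Val unit
    vcon  : ∀ {P} → PVal P P → Val (mu P)
    vinl  : ∀ {a b} → Val a → Val (a ⊕ b)
    vinr  : ∀ {a b} → Val b → Val (a ⊕ b)
    vpair : ∀ {a b} → Val a → Val b → Val (a ⊗ b)

  data PVal : Poly → Poly → Set where
    pid   : ∀ {P} → Val (mu P) → PVal Id P
    pk    : ∀ {γ P} → Val γ → PVal (K γ) P
    pinl  : ∀ {Q R P} → PVal Q P → PVal (Q ⊞ R) P
    pinr  : ∀ {Q R P} → PVal R P → PVal (Q ⊞ R) P
    ppair : ∀ {Q R P} → PVal Q P → PVal R P → PVal (Q ⊠ R) P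

mutual
  size : ∀ {γ} → Val γ → ℕ
  size vunit       = 0
  size (vcon x)    = suc (psize x)
  size (vinl v)    = size v
  size (vinr v)    = size v
  size (vpair v w) = size v + size w

  psize : ∀ {Q P} → PVal Q P → ℕ
  psize (pid v)     = size v
  psize (pk v)      = size v
  psize (pinl x)    = psize x
  psize (pinr x)    = psize x
  psize (ppair x y) = psize x + psize y

-- tree size: values are taken up to bisimilarity, i.e. as their
-- sharing-free unfoldings, so ts_γ(v) is the size of the tree v.
ts : (γ : Ground) → Val γ → ℕ
ts γ v = size v

natP : Poly
natP = K unit ⊞ Id

nat : Ground
nat = mu natP

numeral : ℕ → Val nat
numeral zero    = vcon (pinl (pk vunit))
numeral (suc m) = vcon (pinr (pid (numeral m)))

-- Well-formedness (every μP occurring is nonempty) and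
-- hereditary sequentiality (every polynomial functor has degree ≤ 1).

deg : Poly → ℕ
deg Id      = 1
deg (K _)   = 0
deg (P ⊞ Q) = deg P ⊔ deg Q
deg (P ⊠ Q) = deg P + deg Q

mutual
  data WF : Ground → Set where
    wf-unit : WF unit
    wf-mu   : ∀ {P} → Val (mu P) → WFP P → WF (mu P)
    wf-⊕    : ∀ {a b} → WF a → WF b → WF (a ⊕ b)
    wf-⊗    : ∀ {a b} → WF a → WF b → WF (a ⊗ b)

  data WFP : Poly → Set where
    wfp-id : WFP Id
    wfp-k  : ∀ {γ} → WF γ → WFP (K γ)
    wfp-⊞  : ∀ {P Q} → WFP P → WFP Q → WFP (P ⊞ Q)
    wfp-⊠  : ∀ {P Q} → WFP P → WFP Q → WFP (P ⊠ Q)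

mutual
  data HS : Ground → Set where
    hs-unit : HS unit
    hs-mu   : ∀ {P} → deg P ≤ 1 → HSP P → HS (mu P)
    hs-⊕    : ∀ {a b} → HS a → HS b → HS (a ⊕ b)
    hs-⊗    : ∀ {a b} → HS a → HS b → HS (a ⊗ b)

  data HSP : Poly → Set where
    hsp-id : HSP Id
    hsp-k  : ∀ {γ} → HS γ → HSP (K γ)
    hsp-⊞  : ∀ {P Q} → deg P ≤ 1 → deg Q ≤ 1 → HSP P → HSP Q → HSP (P ⊞ Q)
    hsp-⊠  : ∀ {P Q} → deg P ≤ 1 → deg Q ≤ 1 → HSP P → HSP Q → HSP (P ⊠ Q)

-- Ramified ground types: each μ-base type is tagged normal (N) or safe (S).

data Mode : Set where
  N S : Mode

data RG : Set where
  runit : RG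
  rmu   : Mode → Poly → RG
  _⊕ʳ_  : RG → RG → RG
  _⊗ʳ_  : RG → RG → RG

-- γ with all base types in mode m  (embed N γ : the normal type γ,
-- embed S γ : its safe version Sγ)
embed : Mode → Ground → RG
embed m unit    = runit
embed m (mu P)  = rmu m P
embed m (a ⊕ b) = embed m a ⊕ʳ embed m b
embed m (a ⊗ b) = embed m a ⊗ʳ embed m b

-- setMode S ρ = Sρ ;  setMode N ρ = Nρ (all S removed)
setMode : Mode → RG → RG
setMode m runit     = runit
setMode m (rmu _ P) = rmu m P
setMode m (a ⊕ʳ b)  = setMode m a ⊕ʳ setMode m b
setMode m (a ⊗ʳ b)  = setMode m a ⊗ʳ setMode m b

data AllMode (m : Mode) : RG → Set where
  am-unit : AllMode m runit
  am-mu   : ∀ {P} → AllMode m (rmu m P)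
  am-⊕    : ∀ {a b} → AllMode m a → AllMode m b → AllMode m (a ⊕ʳ b)
  am-⊗    : ∀ {a b} → AllMode m a → AllMode m b → AllMode m (a ⊗ʳ b)

Normal : RG → Set
Normal = AllMode N

Safe : RG → Set
Safe = AllMode S

-- Q(μP) for μP of mode m (constants get mode m as well)
unfoldR : Mode → Poly → Poly → RG
unfoldR m Id      P = rmu m P
unfoldR m (K γ)   P = embed m γ
unfoldR m (Q ⊞ R) P = unfoldR m Q P ⊕ʳ unfoldR m R P
unfoldR m (Q ⊠ R) P = unfoldR m Q P ⊗ʳ unfoldR m R P

-- Q(σ) where Q's constants are normal (data of a normal μP being folded)
unfoldF : Poly → RG → RG
unfoldF Id      σ = σ
unfoldF (K γ)   σ = embed N γ
unfoldF (Q ⊞ R) σ = unfoldF Q σ ⊕ʳ unfoldF R σ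
unfoldF (Q ⊠ R) σ = unfoldF Q σ ⊗ʳ unfoldF R σ

infixr 5 _⇒_
data Ty : Set where
  gr  : RG → Ty
  _⇒_ : RG → Ty → Ty

Ctx : Set
Ctx = List RG

data _∋_ : Ctx → RG → Set where
  here  : ∀ {Γ ρ} → (ρ ∷ Γ) ∋ ρ
  there : ∀ {Γ ρ σ} → Γ ∋ ρ → (σ ∷ Γ) ∋ ρ

data _⊑_ : Ctx → Ctx → Set where
  done : [] ⊑ []
  keep : ∀ {Δ Γ ρ} → Δ ⊑ Γ → (ρ ∷ Δ) ⊑ (ρ ∷ Γ)
  skip : ∀ {Δ Γ ρ} → Δ ⊑ Γ → Δ ⊑ (ρ ∷ Γ)

data AllNormal : Ctx → Set where
  []  : AllNormal []
  _∷_ : ∀ {ρ Γ} → Normal ρ → AllNormal Γ → AllNormal (ρ ∷ Γ)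

data Term (Γ : Ctx) : Ty → Set where
  var    : ∀ {ρ} → Γ ∋ ρ → Term Γ (gr ρ)
  lam    : ∀ {ρ T} → Term (ρ ∷ Γ) T → Term Γ (ρ ⇒ T)
  app    : ∀ {ρ T} → Term Γ (ρ ⇒ T) → Term Γ (gr ρ) → Term Γ T
  unitI  : Term Γ (gr runit)
  pair   : ∀ {ρ σ} → Term Γ (gr ρ) → Term Γ (gr σ) → Term Γ (gr (ρ ⊗ʳ σ))
  fst    : ∀ {ρ σ} → Term Γ (gr (ρ ⊗ʳ σ)) → Term Γ (gr ρ)
  snd    : ∀ {ρ σ} → Term Γ (gr (ρ ⊗ʳ σ)) → Term Γ (gr σ)
  inl    : ∀ {ρ σ} → Term Γ (gr ρ) → Term Γ (gr (ρ ⊕ʳ σ))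
  inr    : ∀ {ρ σ} → Term Γ (gr σ) → Term Γ (gr (ρ ⊕ʳ σ))
  case   : ∀ {ρ σ τ} → Term Γ (gr (ρ ⊕ʳ σ)) →
           Term (ρ ∷ Γ) (gr τ) → Term (σ ∷ Γ) (gr τ) →
           (Normal (ρ ⊕ʳ σ) ⊎ Safe τ) → Term Γ (gr τ)
  con    : (m : Mode) (P : Poly) → Term Γ (gr (unfoldR m P P)) → Term Γ (gr (rmu m P))
  des    : (m : Mode) (P : Poly) → Term Γ (gr (rmu m P)) → Term Γ (gr (unfoldR m P P))
  fold   : (P : Poly) (ρ : RG) →
           Term (unfoldF P (setMode S ρ) ∷ Γ) (gr (setMode S ρ)) →
           Term Γ (gr (rmu N P)) → Term Γ (gr (setMode S ρ))
  toSafe : ∀ {ρ} → Term Γ (gr ρ) → Term Γ (gr (setMode S ρ))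
  -- toNorm: all free variables of the argument (those of Δ ⊑ Γ) normal
  toNorm : ∀ {ρ} (Δ : Ctx) → Δ ⊑ Γ → AllNormal Δ → Term Δ (gr ρ) →
           Term Γ (gr (setMode N ρ))

⟦_⟧ᵍ : RG → Set
⟦ runit ⟧ᵍ   = ⊤
⟦ rmu _ P ⟧ᵍ = Val (mu P)
⟦ a ⊕ʳ b ⟧ᵍ  = ⟦ a ⟧ᵍ ⊎ ⟦ b ⟧ᵍ
⟦ a ⊗ʳ b ⟧ᵍ  = ⟦ a ⟧ᵍ × ⟦ b ⟧ᵍ

⟦_⟧ᵀ : Ty → Set
⟦ gr ρ ⟧ᵀ  = ⟦ ρ ⟧ᵍ
⟦ ρ ⇒ T ⟧ᵀ = ⟦ ρ ⟧ᵍ → ⟦ T ⟧ᵀ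

Env : Ctx → Set
Env []      = ⊤
Env (ρ ∷ Γ) = ⟦ ρ ⟧ᵍ × Env Γ

lookupEnv : ∀ {Γ ρ} → Env Γ → Γ ∋ ρ → ⟦ ρ ⟧ᵍ
lookupEnv (x , _) here      = x
lookupEnv (_ , e) (there i) = lookupEnv e i

thinEnv : ∀ {Δ Γ} → Δ ⊑ Γ → Env Γ → Env Δ
thinEnv done     e       = tt
thinEnv (keep t) (x , e) = x , thinEnv t e
thinEnv (skip t) (_ , e) = thinEnv t e

recast : (m : Mode) (ρ : RG) → ⟦ ρ ⟧ᵍ → ⟦ setMode m ρ ⟧ᵍ
recast m runit     x        = x
recast m (rmu _ P) x        = x
recast m (a ⊕ʳ b)  (inj₁ x) = inj₁ (recast m a x)
recast m (a ⊕ʳ b)  (inj₂ y) = inj₂ (recast m b y)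
recast m (a ⊗ʳ b)  (x , y)  = recast m a x , recast m b y

fromVal : (m : Mode) (γ : Ground) → Val γ → ⟦ embed m γ ⟧ᵍ
fromVal m unit    vunit       = tt
fromVal m (mu P)  v           = v
fromVal m (a ⊕ b) (vinl v)    = inj₁ (fromVal m a v)
fromVal m (a ⊕ b) (vinr v)    = inj₂ (fromVal m b v)
fromVal m (a ⊗ b) (vpair v w) = fromVal m a v , fromVal m b w

toVal : (m : Mode) (γ : Ground) → ⟦ embed m γ ⟧ᵍ → Val γ
toVal m unit    _        = vunit
toVal m (mu P)  v        = v
toVal m (a ⊕ b) (inj₁ x) = vinl (toVal m a x)
toVal m (a ⊕ b) (inj₂ y) = vinr (toVal m b y)
toVal m (a ⊗ b) (x , y)  = vpair (toVal m a x) (toVal m b y)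

unfoldIn : (m : Mode) (Q P : Poly) → ⟦ unfoldR m Q P ⟧ᵍ → PVal Q P
unfoldIn m Id      P v        = pid v
unfoldIn m (K γ)   P x        = pk (toVal m γ x)
unfoldIn m (Q ⊞ R) P (inj₁ x) = pinl (unfoldIn m Q P x)
unfoldIn m (Q ⊞ R) P (inj₂ y) = pinr (unfoldIn m R P y)
unfoldIn m (Q ⊠ R) P (x , y)  = ppair (unfoldIn m Q P x) (unfoldIn m R P y)

unfoldOut : (m : Mode) (Q P : Poly) → PVal Q P → ⟦ unfoldR m Q P ⟧ᵍ
unfoldOut m Id      P (pid v)     = v
unfoldOut m (K γ)   P (pk v)      = fromVal m γ v
unfoldOut m (Q ⊞ R) P (pinl x)    = inj₁ (unfoldOut m Q P x)
unfoldOut m (Q ⊞ R) P (pinr y)    = inj₂ (unfoldOut m R P y)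
unfoldOut m (Q ⊠ R) P (ppair x y) = unfoldOut m Q P x , unfoldOut m R P y

uncon : ∀ {P} → Val (mu P) → PVal P P
uncon (vcon x) = x

module FoldSem (P : Poly) (σ : RG) (alg : ⟦ unfoldF P σ ⟧ᵍ → ⟦ σ ⟧ᵍ) where
  mutual
    foldV : Val (mu P) → ⟦ σ ⟧ᵍ
    foldV (vcon x) = alg (fmapF P x)

    fmapF : (Q : Poly) → PVal Q P → ⟦ unfoldF Q σ ⟧ᵍ
    fmapF Id      (pid v)     = foldV v
    fmapF (K γ)   (pk v)      = fromVal N γ v
    fmapF (Q ⊞ R) (pinl x)    = inj₁ (fmapF Q x)
    fmapF (Q ⊞ R) (pinr y)    = inj₂ (fmapF R y)
    fmapF (Q ⊠ R) (ppair x y) = fmapF Q x , fmapF R y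

eval : ∀ {Γ T} → Term Γ T → Env Γ → ⟦ T ⟧ᵀ
eval (var i)            e = lookupEnv e i
eval (lam t)            e = λ x → eval t (x , e)
eval (app t u)          e = eval t e (eval u e)
eval unitI              e = tt
eval (pair t u)         e = eval t e , eval u e
eval (fst t)            e = proj₁ (eval t e)
eval (snd t)            e = proj₂ (eval t e)
eval (inl t)            e = inj₁ (eval t e)
eval (inr t)            e = inj₂ (eval t e)
eval (case s l r _)     e = [ (λ x → eval l (x , e)) , (λ y → eval r (y , e)) ] (eval s e)
eval (con m P t)        e = vcon (unfoldIn m P P (eval t e))
eval (des m P t)        e = unfoldOut m P P (uncon (eval t e))
eval (fold P ρ t u)     e = FoldSem.foldV P (setMode S ρ) (λ z → eval t (z , e)) (eval u e)
eval (toSafe {ρ} t)     e = recast S ρ (eval t e)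
eval (toNorm {ρ} Δ th _ t) e = recast N ρ (eval t (thinEnv th e))

Computes : (γ γ' : Ground) → Term [] (embed N γ ⇒ gr (embed N γ')) → (Val γ → Val γ') → Set
Computes γ γ' t f = (v : Val γ) → toVal N γ' (eval t tt (fromVal N γ v)) ≡ f v
  where open import Relation.Binary.PropositionalEquality using (_≡_)

RS-computable : (γ γ' : Ground) → (Val γ → Val γ') → Set
RS-computable γ γ' f = Σ (Term [] (embed N γ ⇒ gr (embed N γ'))) (λ t → Computes γ γ' t f)
  where open import Data.Product using (Σ)

{-# OPTIONS --safe #-}
-- Safe numerals admit no addition and fold recurses only on normal data, so the
-- size is counted with an accumulator: a term of type γ → Snat → Snat adds size v
-- successors to its second argument. For μP, the fold body refers to the
-- accumulator a as a free variable, so every recursive result already contains a.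
-- When deg P ≤ 1 each constructor has at most one recursive argument; the other
-- components are counted onto that recursive result (or onto a if there is none),
-- so a is counted exactly once. Starting from zero and applying toNorm, whose
-- argument only mentions the normal input, gives ts γ as a normal numeral.
module Submission where

open import Defs
open import Data.Nat using (ℕ; zero; suc; _+_; _≤_; z≤n; s≤s)
open import Data.Nat.Properties using (+-comm; ≤-trans; m≤m+n; m≤n+m; m≤m⊔n; m≤n⊔m)
open import Data.Sum using (_⊎_; inj₁; inj₂; map₁)
open import Data.Product using (_,_)
open import Data.List using ([]; _∷_)
open import Relation.Binary.PropositionalEquality using (_≡_; refl; cong; trans)

Snat : RG
Snat = rmu S natP

sucᵥ : Val nat → Val nat
sucᵥ a = vcon (pinr (pid a))

_+ᵥ_ : ℕ → Val nat → Val nat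
zero  +ᵥ a = a
suc n +ᵥ a = sucᵥ (n +ᵥ a)

+ᵥ-assoc : ∀ m n a → m +ᵥ (n +ᵥ a) ≡ (m + n) +ᵥ a
+ᵥ-assoc zero    n a = refl
+ᵥ-assoc (suc m) n a = cong sucᵥ (+ᵥ-assoc m n a)

+ᵥ-zero : ∀ n → n +ᵥ numeral 0 ≡ numeral n
+ᵥ-zero zero    = refl
+ᵥ-zero (suc n) = cong sucᵥ (+ᵥ-zero n)

+ᵥ-∘ : (f : Val nat → Val nat) (m n : ℕ) {b c : Val nat} →
       c ≡ n +ᵥ b → f (n +ᵥ b) ≡ m +ᵥ (n +ᵥ b) → f c ≡ (m + n) +ᵥ b
+ᵥ-∘ f m n {b} refl f-adds = trans f-adds (+ᵥ-assoc m n b)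

+≤1⇒≤0 : ∀ m n → m + n ≤ 1 → m ≤ 0 ⊎ n ≤ 0
+≤1⇒≤0 zero    n _       = inj₁ z≤n
+≤1⇒≤0 (suc m) n (s≤s p) = inj₂ (≤-trans (m≤n+m n m) p)

embedN-normal : ∀ γ → Normal (embed N γ)
embedN-normal unit    = am-unit
embedN-normal (mu P)  = am-mu
embedN-normal (a ⊕ b) = am-⊕ (embedN-normal a) (embedN-normal b)
embedN-normal (a ⊗ b) = am-⊗ (embedN-normal a) (embedN-normal b)

mutual
  addSize : (γ : Ground) → HS γ → ∀ {Γ} → Term Γ (embed N γ ⇒ Snat ⇒ gr Snat)
  addSize unit    _            = lam (lam (var here))
  addSize (a ⊕ b) (hs-⊕ ha hb) =
    lam (lam (case (var (there here))
      (app (app (addSize a ha) (var here)) (var (there here)))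
      (app (app (addSize b hb) (var here)) (var (there here)))
      (inj₂ am-mu)))
  addSize (a ⊗ b) (hs-⊗ ha hb) =
    lam (lam (app (app (addSize a ha) (fst (var (there here))))
                  (app (app (addSize b hb) (snd (var (there here)))) (var here))))
  addSize (mu P)  (hs-mu d hp) =
    lam (lam (fold P (rmu N natP) (foldStep P d hp) (var (there here))))

  foldStep : (P : Poly) → deg P ≤ 1 → HSP P → ∀ {Γ} → Term (unfoldF P Snat ∷ Snat ∷ Γ) (gr Snat)
  foldStep P d hp = con S natP (inr (app (app (addPSize P d hp) (var here)) (var (there here))))

  addPSize : (Q : Poly) → deg Q ≤ 1 → HSP Q → ∀ {Γ} → Term Γ (unfoldF Q Snat ⇒ Snat ⇒ gr Snat)
  addPSize Id      _ _         = lam (lam (var (there here)))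
  addPSize (K γ)   _ (hsp-k h) = addSize γ h
  addPSize (Q ⊞ R) _ (hsp-⊞ dq dr hq hr) =
    lam (lam (case (var (there here))
      (app (app (addPSize Q dq hq) (var here)) (var (there here)))
      (app (app (addPSize R dr hr) (var here)) (var (there here)))
      (inj₂ am-mu)))
  -- The component of degree 0 is counted last, onto the result of the other one.
  addPSize (Q ⊠ R) d (hsp-⊠ dq dr hq hr) with +≤1⇒≤0 (deg Q) (deg R) d
  ... | inj₁ _ =
    lam (lam (app (app (addPSize Q dq hq) (fst (var (there here))))
                  (app (app (addPSize R dr hr) (snd (var (there here)))) (var here))))
  ... | inj₂ _ =
    lam (lam (app (app (addPSize R dr hr) (snd (var (there here))))
                  (app (app (addPSize Q dq hq) (fst (var (there here)))) (var here))))

foldStepSem : ∀ P → deg P ≤ 1 → HSP P → ∀ {Γ} → Env Γ → Val nat → ⟦ unfoldF P Snat ⟧ᵍ → Val nat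
foldStepSem P d hp e a z = eval (foldStep P d hp) (z , a , e)

mutual
  addSize-sound : ∀ γ (h : HS γ) {Γ} (e : Env Γ) (v : Val γ) (a : Val nat) →
                  eval (addSize γ h) e (fromVal N γ v) a ≡ size v +ᵥ a
  addSize-sound unit    _            e vunit       a = refl
  addSize-sound (x ⊕ y) (hs-⊕ hx hy) e (vinl v)    a = addSize-sound x hx _ v a
  addSize-sound (x ⊕ y) (hs-⊕ hx hy) e (vinr w)    a = addSize-sound y hy _ w a
  addSize-sound (x ⊗ y) (hs-⊗ hx hy) e (vpair v w) a =
    +ᵥ-∘ (eval (addSize x hx) _ (fromVal N x v)) (size v) (size w)
      (addSize-sound y hy _ w a) (addSize-sound x hx _ v _)
  addSize-sound (mu P)  (hs-mu d hp) e v           a = foldSize-sound P d hp (v , e) a v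

  foldSize-sound : ∀ P (d : deg P ≤ 1) (hp : HSP P) {Γ} (e : Env Γ) (a : Val nat) (v : Val (mu P)) →
                   FoldSem.foldV P Snat (foldStepSem P d hp e a) v ≡ size v +ᵥ a
  foldSize-sound P d hp e a (vcon x) = cong sucᵥ (addPSize-sound P d hp e a P d hp _ x a (inj₂ refl))

  -- Recursive results carry the fixed accumulator a, so a component containing Id
  -- is only correct when it is handed a itself.
  addPSize-sound : ∀ P (d : deg P ≤ 1) (hp : HSP P) {Γ} (e : Env Γ) (a : Val nat)
                   Q (dq : deg Q ≤ 1) (hq : HSP Q) {Δ} (e′ : Env Δ) (x : PVal Q P) (b : Val nat) →
                   deg Q ≤ 0 ⊎ b ≡ a →
                   eval (addPSize Q dq hq) e′ (FoldSem.fmapF P Snat (foldStepSem P d hp e a) Q x) b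
                     ≡ psize x +ᵥ b
  addPSize-sound P d hp e a Id dq hq e′ (pid v) b (inj₁ ())
  addPSize-sound P d hp e a Id dq hq e′ (pid v) b (inj₂ refl) = foldSize-sound P d hp e a v
  addPSize-sound P d hp e a (K γ) dq (hsp-k h) e′ (pk v) b _ = addSize-sound γ h e′ v b
  addPSize-sound P d hp e a (Q ⊞ R) _ (hsp-⊞ dq dr hq hr) e′ (pinl x) b c =
    addPSize-sound P d hp e a Q dq hq _ x b (map₁ (≤-trans (m≤m⊔n (deg Q) (deg R))) c)
  addPSize-sound P d hp e a (Q ⊞ R) _ (hsp-⊞ dq dr hq hr) e′ (pinr y) b c =
    addPSize-sound P d hp e a R dr hr _ y b (map₁ (≤-trans (m≤n⊔m (deg Q) (deg R))) c)
  addPSize-sound P d hp e a (Q ⊠ R) dqr (hsp-⊠ dq dr hq hr) e′ (ppair x y) b c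
    with +≤1⇒≤0 (deg Q) (deg R) dqr
  ... | inj₁ q0 =
    +ᵥ-∘ (eval (addPSize Q dq hq) _ _) (psize x) (psize y)
         (addPSize-sound P d hp e a R dr hr _ y b (map₁ (≤-trans (m≤n+m (deg R) (deg Q))) c))
         (addPSize-sound P d hp e a Q dq hq _ x _ (inj₁ q0))
  ... | inj₂ r0 = trans
    (+ᵥ-∘ (eval (addPSize R dr hr) _ _) (psize y) (psize x)
          (addPSize-sound P d hp e a Q dq hq _ x b (map₁ (≤-trans (m≤m+n (deg Q) (deg R))) c))
          (addPSize-sound P d hp e a R dr hr _ y _ (inj₁ r0)))
    (cong (_+ᵥ b) (+-comm (psize y) (psize x)))

zeroS : ∀ {Γ} → Term Γ (gr Snat)
zeroS = con S natP (inl unitI)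

tsTerm : (γ : Ground) → HS γ → Term [] (embed N γ ⇒ gr (embed N nat))
tsTerm γ h = lam (toNorm {ρ = Snat} (embed N γ ∷ []) (keep done) (embedN-normal γ ∷ [])
                   (app (app (addSize γ h) (var here)) zeroS))

lemma12 : (γ : Ground) → WF γ → HS γ → RS-computable γ nat (λ v → numeral (ts γ v))
lemma12 γ _ h = tsTerm γ h , λ v → trans (addSize-sound γ h _ v (numeral 0)) (+ᵥ-zero (size v))
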